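{- Let $k\ge 1$ and $d\ge 2$ be integers, and let $B_{k,d}$ be the Bethe tree with $k$ levels. Then $$W(B_{k,d})=\frac{d^k}{(d-1)^3}\Big[(k-1)(d-1)(d^k+1)-2d\,(d^{k-1}-1)\Big].$$
   Context: The Wiener index of a connected graph $G$ is $W(G)=\sum_{\{u,v\}\subseteq V(G)} d(u,v)$, summing distances over unordered pairs of distinct vertices. The Bethe tree $B_{k,d}$ is the rooted tree with $k$ levels (root at level $1$) in which the root has degree $d$, each vertex on levels $2,\dots,k-1$ has degree $d+1$ (i.e. $d$ children), and the vertices on level $k$ are pendent. -}

module Defs where

open import Data.Nat using (ℕ; zero; suc; _<_; _≤_)
open import Data.Fin using (Fin)
open import Data.List using (List; []; _∷_; [_]; length; map; concatMap; allFin; _++_)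
open import Data.Nat.ListAction using (sum)
open import Data.Product using (Σ; ∃; _,_; _×_; proj₁; proj₂)
open import Data.Sum using (_⊎_)
open import Relation.Binary.PropositionalEquality using (_≡_)

-- Vertices of the Bethe tree B_{k,d}: a vertex on level (m+1) is encoded by
-- the list of child indices (each in Fin d) on the path from it up to the
-- root (head = last step taken from its parent).
Vtx : ℕ → Set
Vtx d = List (Fin d)

InTree : (k d : ℕ) → Vtx d → Set
InTree k d u = length u < k

Adj : {d : ℕ} → Vtx d → Vtx d → Set
Adj u v = (∃ λ i → v ≡ i ∷ u) ⊎ (∃ λ i → u ≡ i ∷ v)

data Walk (k d : ℕ) : Vtx d → Vtx d → ℕ → Set where
  here : ∀ {u} → Walk k d u u 0
  step : ∀ {u w v n} → Adj u w → InTree k d w → Walk k d w v n → Walk k d u v (suc n)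

IsDistance : (k d : ℕ) → (Vtx d → Vtx d → ℕ) → Set
IsDistance k d dist =
  ∀ u v → InTree k d u → InTree k d v →
    Walk k d u v (dist u v) × (∀ n → Walk k d u v n → dist u v ≤ n)

level : (d : ℕ) → ℕ → List (Vtx d)
level d zero = [ [] ]
level d (suc m) = concatMap (λ l → map (λ i → i ∷ l) (allFin d)) (level d m)

vertices : (k d : ℕ) → List (Vtx d)
vertices zero d = []
vertices (suc k) d = vertices k d ++ level d k

pairs : {A : Set} → List A → List (A × A)
pairs [] = []
pairs (x ∷ xs) = map (λ y → x , y) xs ++ pairs xs

wiener : (k d : ℕ) → (Vtx d → Vtx d → ℕ) → ℕ
wiener k d dist = sum (map (λ p → dist (proj₁ p) (proj₂ p)) (pairs (vertices k d)))

-- Write a vertex of B_{k,d} as its path from the root.  The distance of two vertices is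
-- the sum of the lengths their paths have left after the longest common prefix (the path
-- to their lowest common ancestor).  Deleting the root splits B_{k+1,d} into d copies of
-- B_{k,d}, and two vertices in different copies are at distance depth + depth.  This gives,
-- for the number of vertices n_k, the total depth s_k and D_k = 2 W(B_{k,d}),
--   n_{k+1} = 1 + d n_k,   s_{k+1} = d (n_k + s_k),
--   D_{k+1} = 2d (n_k + s_k) + d D_k + 2d (d - 1) n_k (n_k + s_k).
-- With c = d - 1 and x = d^k these are solved by c n_k = x - 1, c² s_k = k c x - d (x - 1)
-- and c³ D_k = 2x ((k - 1) c (x + 1) - 2 (x - d)), checked by induction in ℤ.

module Submission where

open import Defs

open import Data.Empty using (⊥-elim)
open import Data.Fin using (Fin; zero; suc; _≟_)
import Data.Fin.Properties as Fin
open import Data.List using (List; []; _∷_; [_]; length; map; concatMap; allFin; _++_; _∷ʳ_; reverse)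
open import Data.List.Properties
  using (map-cong; map-cong-local; map-++; length-++; map-∘; map-tabulate; length-tabulate;
         length-reverse; reverse-++; unfold-reverse; reverse-injective)
open import Data.List.Relation.Unary.All as All using (All; []; _∷_)
open import Data.List.Relation.Unary.All.Properties using (map⁺; gmap⁺; ++⁺; concat⁺)
open import Data.Nat using (ℕ; zero; suc; _≤_; _∸_; _^_)
open import Data.Product using (_,_; _×_; proj₁; proj₂)
open import Data.Sum using (_⊎_; inj₁; inj₂)
open import Function using (_∘_; id)
open import Relation.Binary.PropositionalEquality hiding ([_])
open import Relation.Nullary using (yes; no)

private variable A B : Set

module Sums where

  open import Data.Nat using (_+_; _*_)
  open import Data.Nat.ListAction using (sum)
  open import Data.Nat.ListAction.Properties using (sum-++)
  open import Data.Nat.Properties using (*-zeroʳ; *-identityʳ; *-distribˡ-+; +-commutativeSemigroup)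
  open import Algebra.Properties.CommutativeSemigroup +-commutativeSemigroup using (interchange; x∙yz≈y∙xz)
  import Data.Nat.Tactic.RingSolver as ℕ-Solver

  ∑ : List A → (A → ℕ) → ℕ
  ∑ xs f = sum (map f xs)

  -- The summand extends over one application only: ∑[ x ∈ xs ] f x + c means (∑[ x ∈ xs ] f x) + c.
  syntax ∑ xs (λ x → e) = ∑[ x ∈ xs ] e

  ∑-cong : ∀ (xs : List A) {f g : A → ℕ} → (∀ x → f x ≡ g x) → ∑ xs f ≡ ∑ xs g
  ∑-cong xs f≗g = cong sum (map-cong f≗g xs)

  ∑-cong-All : ∀ {P : A → Set} {xs : List A} {f g : A → ℕ} →
               All P xs → (∀ {x} → P x → f x ≡ g x) → ∑ xs f ≡ ∑ xs g
  ∑-cong-All Pxs f≗g = cong sum (map-cong-local (All.map f≗g Pxs))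

  ∑-++ : ∀ (xs ys : List A) f → ∑ (xs ++ ys) f ≡ ∑ xs f + ∑ ys f
  ∑-++ xs ys f = trans (cong sum (map-++ f xs ys)) (sum-++ (map f xs) (map f ys))

  ∑-map : ∀ (g : A → B) (xs : List A) (f : B → ℕ) → ∑ (map g xs) f ≡ ∑ xs (f ∘ g)
  ∑-map g xs f = cong sum (sym (map-∘ xs))

  ∑-concatMap : ∀ (g : A → List B) (xs : List A) (f : B → ℕ) →
                ∑ (concatMap g xs) f ≡ ∑[ x ∈ xs ] ∑ (g x) f
  ∑-concatMap g [] f = refl
  ∑-concatMap g (x ∷ xs) f =
    trans (∑-++ (g x) (concatMap g xs) f) (cong (∑ (g x) f +_) (∑-concatMap g xs f))

  ∑-distrib-+ : ∀ (xs : List A) f g → ∑[ x ∈ xs ] (f x + g x) ≡ ∑ xs f + ∑ xs g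
  ∑-distrib-+ [] f g = refl
  ∑-distrib-+ (x ∷ xs) f g =
    trans (cong (f x + g x +_) (∑-distrib-+ xs f g)) (interchange (f x) (g x) _ _)

  *-distribˡ-∑ : ∀ (xs : List A) c f → ∑[ x ∈ xs ] (c * f x) ≡ c * ∑ xs f
  *-distribˡ-∑ [] c f = sym (*-zeroʳ c)
  *-distribˡ-∑ (x ∷ xs) c f =
    trans (cong (c * f x +_) (*-distribˡ-∑ xs c f)) (sym (*-distribˡ-+ c (f x) (∑ xs f)))

  ∑-const : ∀ (xs : List A) c → ∑[ _ ∈ xs ] c ≡ length xs * c
  ∑-const [] c = refl
  ∑-const (x ∷ xs) c = cong (c +_) (∑-const xs c)

  ∑-count : ∀ (xs : List A) → ∑[ _ ∈ xs ] 1 ≡ length xs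
  ∑-count xs = trans (∑-const xs 1) (*-identityʳ (length xs))

  ∑-allFin-const : ∀ n c → ∑[ _ ∈ allFin n ] c ≡ n * c
  ∑-allFin-const n c = trans (∑-const (allFin n) c) (cong (_* c) (length-tabulate {n = n} id))

  ∑-allFin-suc : ∀ n (f : Fin (suc n) → ℕ) → ∑ (allFin (suc n)) f ≡ f zero + ∑[ j ∈ allFin n ] f (suc j)
  ∑-allFin-suc n f =
    cong (f zero +_) (trans (cong (λ js → ∑ js f) (sym (map-tabulate id suc))) (∑-map suc (allFin n) f))

  ∑-allFin-except : ∀ n (h : Fin (suc n) → ℕ) i {b} → (∀ j → i ≢ j → h j ≡ b) →
                    ∑ (allFin (suc n)) h ≡ h i + n * b
  ∑-allFin-except n h zero {b} h≡b = trans (∑-allFin-suc n h) (cong (h zero +_) (begin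
    ∑[ j ∈ allFin n ] h (suc j)  ≡⟨ ∑-cong (allFin n) (λ j → h≡b (suc j) λ ()) ⟩
    ∑[ _ ∈ allFin n ] b          ≡⟨ ∑-allFin-const n b ⟩
    n * b                        ∎))
    where open ≡-Reasoning
  ∑-allFin-except (suc n) h (suc i) {b} h≡b = begin
    ∑ (allFin (suc (suc n))) h                  ≡⟨ ∑-allFin-suc (suc n) h ⟩
    h zero + ∑[ j ∈ allFin (suc n) ] h (suc j)  ≡⟨ cong₂ _+_ (h≡b zero λ ()) rest ⟩
    b + (h (suc i) + n * b)                     ≡⟨ x∙yz≈y∙xz b (h (suc i)) (n * b) ⟩
    h (suc i) + suc n * b                       ∎
    where
    open ≡-Reasoning
    rest : ∑[ j ∈ allFin (suc n) ] h (suc j) ≡ h (suc i) + n * b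
    rest = ∑-allFin-except n (h ∘ suc) i (λ j i≢j → h≡b (suc j) (i≢j ∘ Fin.suc-injective))

  pairs-All : ∀ {P : A → Set} {xs} → All P xs → All (λ p → P (proj₁ p) × P (proj₂ p)) (pairs xs)
  pairs-All [] = []
  pairs-All (px ∷ pxs) = ++⁺ (map⁺ (All.map (px ,_) pxs)) (pairs-All pxs)

  ∑-pairs : ∀ (g : A → A → ℕ) → (∀ x y → g x y ≡ g y x) → (∀ x → g x x ≡ 0) → ∀ xs →
            2 * ∑[ p ∈ pairs xs ] g (proj₁ p) (proj₂ p) ≡ ∑[ x ∈ xs ] ∑[ y ∈ xs ] g x y
  ∑-pairs g g-sym g-diag [] = refl
  ∑-pairs g g-sym g-diag (x ∷ xs) = begin
    2 * ∑[ p ∈ pairs (x ∷ xs) ] g (proj₁ p) (proj₂ p)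
      ≡⟨ cong (2 *_) (trans (∑-++ (map (x ,_) xs) (pairs xs) _) (cong (_+ _) (∑-map (x ,_) xs _))) ⟩
    2 * (row + ∑[ p ∈ pairs xs ] g (proj₁ p) (proj₂ p))
      ≡⟨ double-+ row _ ⟩
    row + (row + 2 * ∑[ p ∈ pairs xs ] g (proj₁ p) (proj₂ p))
      ≡⟨ cong₂ (λ a b → a + (b + _)) (cong (_+ row) (g-diag x)) (∑-cong xs λ y → g-sym y x) ⟨
    (g x x + row) + (∑[ y ∈ xs ] g y x + 2 * ∑[ p ∈ pairs xs ] g (proj₁ p) (proj₂ p))
      ≡⟨ cong (λ t → (g x x + row) + (∑[ y ∈ xs ] g y x + t)) (∑-pairs g g-sym g-diag xs) ⟩
    (g x x + row) + (∑[ y ∈ xs ] g y x + ∑[ y ∈ xs ] ∑[ z ∈ xs ] g y z)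
      ≡⟨ cong ((g x x + row) +_) (∑-distrib-+ xs (λ y → g y x) _) ⟨
    ∑[ y ∈ x ∷ xs ] ∑[ z ∈ x ∷ xs ] g y z ∎
    where
    open ≡-Reasoning
    row : ℕ
    row = ∑[ y ∈ xs ] g x y
    double-+ : ∀ a b → 2 * (a + b) ≡ a + (a + 2 * b)
    double-+ = ℕ-Solver.solve-∀

module BetheTree where

  open Sums
  open import Data.Nat hiding (_≟_)
  open import Data.Nat.Properties hiding (_≟_)

  module _ (d : ℕ) where

    ∑-level-parents : ∀ m f → ∑ (level d (suc m)) f ≡ ∑[ l ∈ level d m ] ∑[ i ∈ allFin d ] f (i ∷ l)
    ∑-level-parents m f = trans (∑-concatMap _ (level d m) f)
      (∑-cong (level d m) λ l → ∑-map (_∷ l) (allFin d) f)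

    ∑-level-subtrees : ∀ m f →
      ∑ (level d (suc m)) f ≡ ∑[ i ∈ allFin d ] ∑[ l ∈ level d m ] f (l ∷ʳ i)
    ∑-level-subtrees zero f = trans (∑-level-parents zero f)
      (trans (+-identityʳ _) (∑-cong (allFin d) λ i → sym (+-identityʳ (f [ i ]))))
    ∑-level-subtrees (suc m) f = begin
      ∑ (level d (suc (suc m))) f
        ≡⟨ ∑-level-parents (suc m) f ⟩
      ∑[ l ∈ level d (suc m) ] ∑[ i ∈ allFin d ] f (i ∷ l)
        ≡⟨ ∑-level-subtrees m _ ⟩
      ∑[ j ∈ allFin d ] ∑[ l ∈ level d m ] ∑[ i ∈ allFin d ] f (i ∷ l ∷ʳ j)
        ≡⟨ ∑-cong (allFin d) (λ j → sym (∑-level-parents m (f ∘ (_∷ʳ j)))) ⟩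
      ∑[ j ∈ allFin d ] ∑[ l ∈ level d (suc m) ] f (l ∷ʳ j) ∎
      where open ≡-Reasoning

    ∑-vertices-subtrees : ∀ k f →
      ∑ (vertices (suc k) d) f ≡ f [] + ∑[ i ∈ allFin d ] ∑[ v ∈ vertices k d ] f (v ∷ʳ i)
    ∑-vertices-subtrees zero f = cong (f [] +_) (sym (trans (∑-allFin-const d 0) (*-zeroʳ d)))
    ∑-vertices-subtrees (suc k) f = begin
      ∑ (vertices (suc k) d ++ level d (suc k)) f
        ≡⟨ ∑-++ (vertices (suc k) d) _ f ⟩
      ∑ (vertices (suc k) d) f + ∑ (level d (suc k)) f
        ≡⟨ cong₂ _+_ (∑-vertices-subtrees k f) (∑-level-subtrees k f) ⟩
      f [] + ∑[ i ∈ allFin d ] subtree (vertices k d) i + ∑[ i ∈ allFin d ] subtree (level d k) i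
        ≡⟨ +-assoc (f []) _ _ ⟩
      f [] + (∑[ i ∈ allFin d ] subtree (vertices k d) i + ∑[ i ∈ allFin d ] subtree (level d k) i)
        ≡⟨ cong (f [] +_) (sym (∑-distrib-+ (allFin d) _ _)) ⟩
      f [] + ∑[ i ∈ allFin d ] (subtree (vertices k d) i + subtree (level d k) i)
        ≡⟨ cong (f [] +_) (∑-cong (allFin d) λ i → sym (∑-++ (vertices k d) (level d k) _)) ⟩
      f [] + ∑[ i ∈ allFin d ] subtree (vertices (suc k) d) i ∎
      where
      open ≡-Reasoning
      subtree : List (Vtx d) → Fin d → ℕ
      subtree vs i = ∑[ v ∈ vs ] f (v ∷ʳ i)

    level-length : ∀ m → All (λ l → length l ≡ m) (level d m)
    level-length zero = refl ∷ []
    level-length (suc m) =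
      concat⁺ (gmap⁺ (λ |l|≡m → map⁺ (All.universal (λ _ → cong suc |l|≡m) (allFin d)))
                     (level-length m))

    vertices-inTree : ∀ k → All (InTree k d) (vertices k d)
    vertices-inTree zero = []
    vertices-inTree (suc k) =
      ++⁺ (All.map m<n⇒m<1+n (vertices-inTree k))
          (All.map (λ |u|≡k → s≤s (≤-reflexive |u|≡k)) (level-length k))

  length-∷ʳ : ∀ (xs : List A) x → length (xs ∷ʳ x) ≡ suc (length xs)
  length-∷ʳ xs x = trans (length-++ xs) (+-comm (length xs) 1)

  reverse-∷ʳ : ∀ (xs : List A) x → reverse (xs ∷ʳ x) ≡ x ∷ reverse xs
  reverse-∷ʳ xs x = reverse-++ xs [ x ]

  module _ {d : ℕ} where

    pathDist : List (Fin d) → List (Fin d) → ℕ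
    pathDist [] y = length y
    pathDist (a ∷ x) [] = length (a ∷ x)
    pathDist (a ∷ x) (b ∷ y) with a ≟ b
    ... | yes _ = pathDist x y
    ... | no _ = length (a ∷ x) + length (b ∷ y)

    pathDist-diag : ∀ x → pathDist x x ≡ 0
    pathDist-diag [] = refl
    pathDist-diag (a ∷ x) with a ≟ a
    ... | yes _ = pathDist-diag x
    ... | no a≢a = ⊥-elim (a≢a refl)

    pathDist-sym : ∀ x y → pathDist x y ≡ pathDist y x
    pathDist-sym [] [] = refl
    pathDist-sym [] (b ∷ y) = refl
    pathDist-sym (a ∷ x) [] = refl
    pathDist-sym (a ∷ x) (b ∷ y) with a ≟ b | b ≟ a
    ... | yes _   | yes _   = pathDist-sym x y
    ... | yes a≡b | no b≢a  = ⊥-elim (b≢a (sym a≡b))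
    ... | no a≢b  | yes b≡a = ⊥-elim (a≢b (sym b≡a))
    ... | no _    | no _    = +-comm (length (a ∷ x)) (length (b ∷ y))

    pathDist≡0⇒≡ : ∀ x y → pathDist x y ≡ 0 → x ≡ y
    pathDist≡0⇒≡ [] [] _ = refl
    pathDist≡0⇒≡ (a ∷ x) (b ∷ y) eq with a ≟ b
    ... | yes refl = cong (a ∷_) (pathDist≡0⇒≡ x y eq)

    pathDist-∷ʳ : ∀ x i y →
      pathDist (x ∷ʳ i) y ≡ suc (pathDist x y) ⊎ suc (pathDist (x ∷ʳ i) y) ≡ pathDist x y
    pathDist-∷ʳ [] i [] = inj₁ refl
    pathDist-∷ʳ [] i (b ∷ y) with i ≟ b
    ... | yes _ = inj₂ refl
    ... | no _ = inj₁ refl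
    pathDist-∷ʳ (a ∷ x) i [] = inj₁ (cong suc (length-∷ʳ x i))
    pathDist-∷ʳ (a ∷ x) i (b ∷ y) with a ≟ b
    ... | yes _ = pathDist-∷ʳ x i y
    ... | no _ = inj₁ (cong (λ n → suc n + length (b ∷ y)) (length-∷ʳ x i))

    pathDist-∷ʳ-away : ∀ x i y → length y ≤ suc (length x) → x ∷ʳ i ≢ y →
                       pathDist (x ∷ʳ i) y ≡ suc (pathDist x y)
    pathDist-∷ʳ-away [] i [] _ _ = refl
    pathDist-∷ʳ-away [] i (b ∷ []) _ [i]≢[b] with i ≟ b
    ... | yes refl = ⊥-elim ([i]≢[b] refl)
    ... | no _ = refl
    pathDist-∷ʳ-away [] i (_ ∷ _ ∷ _) (s≤s ()) _
    pathDist-∷ʳ-away (a ∷ x) i [] _ _ = cong suc (length-∷ʳ x i)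
    pathDist-∷ʳ-away (a ∷ x) i (b ∷ y) (s≤s |y|≤1+|x|) ne with a ≟ b
    ... | yes refl = pathDist-∷ʳ-away x i y |y|≤1+|x| (ne ∘ cong (a ∷_))
    ... | no _ = cong (λ n → suc n + length (b ∷ y)) (length-∷ʳ x i)

    -- Defs stores the path of a vertex leaf-first (head = last step); pathDist reads it root-first.
    treeDist : Vtx d → Vtx d → ℕ
    treeDist u v = pathDist (reverse u) (reverse v)

    treeDist-diag : ∀ u → treeDist u u ≡ 0
    treeDist-diag u = pathDist-diag (reverse u)

    treeDist-sym : ∀ u v → treeDist u v ≡ treeDist v u
    treeDist-sym u v = pathDist-sym (reverse u) (reverse v)

    treeDist≡0⇒≡ : ∀ u v → treeDist u v ≡ 0 → u ≡ v
    treeDist≡0⇒≡ u v eq = reverse-injective (pathDist≡0⇒≡ (reverse u) (reverse v) eq)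

    treeDist≡suc⇒≢ : ∀ {u v n} → treeDist u v ≡ suc n → u ≢ v
    treeDist≡suc⇒≢ {u} eq refl = 0≢1+n (trans (sym (treeDist-diag u)) eq)

    treeDist-child : ∀ i u v →
      treeDist (i ∷ u) v ≡ suc (treeDist u v) ⊎ suc (treeDist (i ∷ u) v) ≡ treeDist u v
    treeDist-child i u v rewrite unfold-reverse i u = pathDist-∷ʳ (reverse u) i (reverse v)

    treeDist-parent : ∀ i u v → length v ≤ length (i ∷ u) → i ∷ u ≢ v →
                      treeDist (i ∷ u) v ≡ suc (treeDist u v)
    treeDist-parent i u v |v|≤1+|u| i∷u≢v rewrite unfold-reverse i u =
      pathDist-∷ʳ-away (reverse u) i (reverse v)
        (subst₂ (λ m n → m ≤ suc n) (sym (length-reverse v)) (sym (length-reverse u)) |v|≤1+|u|)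
        (λ eq → i∷u≢v (reverse-injective (trans (unfold-reverse i u) eq)))

    treeDist-Adj : ∀ {u w} v → Adj u w → treeDist u v ≤ suc (treeDist w v)
    treeDist-Adj {u} v (inj₁ (i , refl)) with treeDist-child i u v
    ... | inj₁ up rewrite up = m≤n⇒m≤1+n (n≤1+n _)
    ... | inj₂ down = ≤-reflexive (sym down)
    treeDist-Adj {w = w} v (inj₂ (i , refl)) with treeDist-child i w v
    ... | inj₁ up = ≤-reflexive up
    ... | inj₂ down = m≤n⇒m≤1+n (≤-trans (n≤1+n _) (≤-reflexive down))

    treeDist-root : ∀ v → treeDist [] v ≡ length v
    treeDist-root = length-reverse

    treeDist-∷ʳ-root : ∀ u i → treeDist (u ∷ʳ i) [] ≡ suc (length u)
    treeDist-∷ʳ-root u i = trans (treeDist-sym (u ∷ʳ i) []) (trans (treeDist-root (u ∷ʳ i)) (length-∷ʳ u i))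

    treeDist-sameSubtree : ∀ u v i → treeDist (u ∷ʳ i) (v ∷ʳ i) ≡ treeDist u v
    treeDist-sameSubtree u v i rewrite reverse-∷ʳ u i | reverse-∷ʳ v i with i ≟ i
    ... | yes _ = refl
    ... | no i≢i = ⊥-elim (i≢i refl)

    treeDist-crossSubtree : ∀ u v {i j} → i ≢ j →
                            treeDist (u ∷ʳ i) (v ∷ʳ j) ≡ suc (length u) + suc (length v)
    treeDist-crossSubtree u v {i} {j} i≢j rewrite reverse-∷ʳ u i | reverse-∷ʳ v j with i ≟ j
    ... | yes i≡j = ⊥-elim (i≢j i≡j)
    ... | no _ = cong₂ (λ a b → suc a + suc b) (length-reverse u) (length-reverse v)

  module _ {k d : ℕ} where

    treeDist≤walk : ∀ {u v n} → Walk k d u v n → treeDist u v ≤ n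
    treeDist≤walk {v = v} here = ≤-reflexive (treeDist-diag v)
    treeDist≤walk {v = v} (step u~w _ w⇝v) = ≤-trans (treeDist-Adj v u~w) (s≤s (treeDist≤walk w⇝v))

    walk-snoc : ∀ {u w v n} → Walk k d u w n → Adj w v → InTree k d v → Walk k d u v (suc n)
    walk-snoc here w~v v∈ = step w~v v∈ here
    walk-snoc (step u~x x∈ x⇝w) w~v v∈ = step u~x x∈ (walk-snoc x⇝w w~v v∈)

    parent-inTree : ∀ {i u} → InTree k d (i ∷ u) → InTree k d u
    parent-inTree = <-trans (n<1+n _)

    -- Moving the deeper endpoint to its parent lowers the distance by one.
    walk-of-treeDist : ∀ n u v → InTree k d u → InTree k d v → treeDist u v ≡ n → Walk k d u v n
    walk-of-treeDist zero u v _ _ eq with treeDist≡0⇒≡ u v eq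
    ... | refl = here
    walk-of-treeDist (suc n) u v u∈ v∈ eq with length v ≤? length u
    walk-of-treeDist (suc n) [] [] _ _ () | yes _
    walk-of-treeDist (suc n) [] (_ ∷ _) _ _ _ | yes ()
    walk-of-treeDist (suc n) (i ∷ u) v u∈ v∈ eq | yes |v|≤|u| =
      step (inj₂ (i , refl)) u'∈ (walk-of-treeDist n u v u'∈ v∈
        (suc-injective (trans (sym (treeDist-parent i u v |v|≤|u| (treeDist≡suc⇒≢ eq))) eq)))
      where
      u'∈ : InTree k d u
      u'∈ = parent-inTree {i} {u} u∈
    walk-of-treeDist (suc n) u [] _ _ _ | no |v|≰|u| = ⊥-elim (|v|≰|u| z≤n)
    walk-of-treeDist (suc n) u (j ∷ v) u∈ v∈ eq | no |v|≰|u| =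
      walk-snoc (walk-of-treeDist n u v u∈ (parent-inTree {j} {v} v∈) (suc-injective (begin
        suc (treeDist u v)  ≡⟨ cong suc (treeDist-sym u v) ⟩
        suc (treeDist v u)  ≡⟨ sym (treeDist-parent j v u |u|≤|v|+1 (treeDist≡suc⇒≢ eq ∘ sym)) ⟩
        treeDist (j ∷ v) u  ≡⟨ treeDist-sym (j ∷ v) u ⟩
        treeDist u (j ∷ v)  ≡⟨ eq ⟩
        suc n               ∎))) (inj₁ (j , refl)) v∈
      where
      open ≡-Reasoning
      |u|≤|v|+1 : length u ≤ length (j ∷ v)
      |u|≤|v|+1 = <⇒≤ (≰⇒> |v|≰|u|)

    dist≡treeDist : ∀ {dist} → IsDistance k d dist →
                    ∀ {u v} → InTree k d u → InTree k d v → dist u v ≡ treeDist u v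
    dist≡treeDist isDist {u} {v} u∈ v∈ = ≤-antisym
      (proj₂ (isDist u v u∈ v∈) _ (walk-of-treeDist _ u v u∈ v∈ refl))
      (treeDist≤walk (proj₁ (isDist u v u∈ v∈)))

  2*wiener≡∑∑treeDist : ∀ k d {dist} → IsDistance k d dist →
                        2 * wiener k d dist ≡ ∑[ u ∈ vertices k d ] ∑[ v ∈ vertices k d ] treeDist u v
  2*wiener≡∑∑treeDist k d isDist = trans
    (cong (2 *_) (∑-cong-All (pairs-All (vertices-inTree d k)) λ (u∈ , v∈) → dist≡treeDist isDist u∈ v∈))
    (∑-pairs treeDist treeDist-sym treeDist-diag (vertices k d))

  module Recurrences (c : ℕ) where

    private
      d : ℕ
      d = suc c

      V : ℕ → List (Vtx d)
      V k = vertices k d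

    order depthSum : ℕ → ℕ
    order k = length (V k)
    depthSum k = ∑[ v ∈ V k ] length v

    distanceRow crossRow : ℕ → Vtx d → ℕ
    distanceRow k u = ∑[ v ∈ V k ] treeDist u v
    crossRow k u = ∑[ v ∈ V k ] (suc (length u) + suc (length v))

    distanceSum crossSum : ℕ → ℕ
    distanceSum k = ∑ (V k) (distanceRow k)
    crossSum k = ∑ (V k) (crossRow k)

    ∑-suc-length : ∀ k → ∑[ v ∈ V k ] suc (length v) ≡ order k + depthSum k
    ∑-suc-length k = trans (∑-distrib-+ (V k) (λ _ → 1) length) (cong (_+ depthSum k) (∑-count (V k)))

    order-suc : ∀ k → order (suc k) ≡ 1 + d * order k
    order-suc k = begin
      order (suc k)
        ≡⟨ ∑-count (V (suc k)) ⟨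
      ∑[ _ ∈ V (suc k) ] 1
        ≡⟨ ∑-vertices-subtrees d k _ ⟩
      1 + ∑[ _ ∈ allFin d ] ∑[ _ ∈ V k ] 1
        ≡⟨ cong (1 +_) (∑-cong (allFin d) λ _ → ∑-count (V k)) ⟩
      1 + ∑[ _ ∈ allFin d ] order k
        ≡⟨ cong (1 +_) (∑-allFin-const d (order k)) ⟩
      1 + d * order k ∎
      where open ≡-Reasoning

    depthSum-suc : ∀ k → depthSum (suc k) ≡ d * (order k + depthSum k)
    depthSum-suc k = begin
      depthSum (suc k)
        ≡⟨ ∑-vertices-subtrees d k length ⟩
      ∑[ i ∈ allFin d ] ∑[ v ∈ V k ] length (v ∷ʳ i)
        ≡⟨ ∑-cong (allFin d) (λ i → ∑-cong (V k) λ v → length-∷ʳ v i) ⟩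
      ∑[ _ ∈ allFin d ] ∑[ v ∈ V k ] suc (length v)
        ≡⟨ ∑-cong (allFin d) (λ _ → ∑-suc-length k) ⟩
      ∑[ _ ∈ allFin d ] (order k + depthSum k)
        ≡⟨ ∑-allFin-const d _ ⟩
      d * (order k + depthSum k) ∎
      where open ≡-Reasoning

    crossSum-closed : ∀ k → crossSum k ≡ order k * (order k + depthSum k) + order k * (order k + depthSum k)
    crossSum-closed k = begin
      crossSum k
        ≡⟨ ∑-cong (V k) (λ u → ∑-distrib-+ (V k) (λ _ → suc (length u)) (suc ∘ length)) ⟩
      ∑[ u ∈ V k ] (∑[ _ ∈ V k ] suc (length u) + ∑[ v ∈ V k ] suc (length v))
        ≡⟨ ∑-cong (V k) (λ u → cong₂ _+_ (∑-const (V k) (suc (length u))) (∑-suc-length k)) ⟩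
      ∑[ u ∈ V k ] (order k * suc (length u) + (order k + depthSum k))
        ≡⟨ ∑-distrib-+ (V k) _ _ ⟩
      ∑[ u ∈ V k ] (order k * suc (length u)) + ∑[ _ ∈ V k ] (order k + depthSum k)
        ≡⟨ cong₂ _+_ (trans (*-distribˡ-∑ (V k) (order k) _) (cong (order k *_) (∑-suc-length k)))
                     (∑-const (V k) _) ⟩
      order k * (order k + depthSum k) + order k * (order k + depthSum k) ∎
      where open ≡-Reasoning

    distanceRow-subtree : ∀ k u i →
      distanceRow (suc k) (u ∷ʳ i) ≡ suc (length u) + (distanceRow k u + c * crossRow k u)
    distanceRow-subtree k u i = begin
      distanceRow (suc k) (u ∷ʳ i)
        ≡⟨ ∑-vertices-subtrees d k _ ⟩
      treeDist (u ∷ʳ i) [] + ∑[ j ∈ allFin d ] ∑[ v ∈ V k ] treeDist (u ∷ʳ i) (v ∷ʳ j)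
        ≡⟨ cong₂ _+_ (treeDist-∷ʳ-root u i)
             (∑-allFin-except c _ i λ j i≢j → ∑-cong (V k) λ v → treeDist-crossSubtree u v i≢j) ⟩
      suc (length u) + (∑[ v ∈ V k ] treeDist (u ∷ʳ i) (v ∷ʳ i) + c * crossRow k u)
        ≡⟨ cong (λ t → suc (length u) + (t + c * crossRow k u))
                (∑-cong (V k) λ v → treeDist-sameSubtree u v i) ⟩
      suc (length u) + (distanceRow k u + c * crossRow k u) ∎
      where open ≡-Reasoning

    distanceSum-suc : ∀ k → distanceSum (suc k) ≡
      d * (order k + depthSum k) + d * ((order k + depthSum k) + (distanceSum k + c * crossSum k))
    distanceSum-suc k = begin
      distanceSum (suc k)
        ≡⟨ ∑-vertices-subtrees d k _ ⟩
      distanceRow (suc k) [] + ∑[ i ∈ allFin d ] ∑[ u ∈ V k ] distanceRow (suc k) (u ∷ʳ i)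
        ≡⟨ cong₂ _+_ (trans (∑-cong (V (suc k)) treeDist-root) (depthSum-suc k))
                     (∑-cong (allFin d) λ i → ∑-cong (V k) λ u → distanceRow-subtree k u i) ⟩
      d * (order k + depthSum k) + ∑[ _ ∈ allFin d ] ∑[ u ∈ V k ] subtreeRow u
        ≡⟨ cong (d * (order k + depthSum k) +_) (∑-allFin-const d _) ⟩
      d * (order k + depthSum k) + d * ∑[ u ∈ V k ] subtreeRow u
        ≡⟨ cong (λ t → d * (order k + depthSum k) + d * t) ∑-subtreeRow ⟩
      d * (order k + depthSum k) + d * ((order k + depthSum k) + (distanceSum k + c * crossSum k)) ∎
      where
      open ≡-Reasoning
      subtreeRow : Vtx d → ℕ
      subtreeRow u = suc (length u) + (distanceRow k u + c * crossRow k u)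
      ∑-subtreeRow : ∑[ u ∈ V k ] subtreeRow u ≡ (order k + depthSum k) + (distanceSum k + c * crossSum k)
      ∑-subtreeRow = trans (∑-distrib-+ (V k) _ _) (cong₂ _+_ (∑-suc-length k)
        (trans (∑-distrib-+ (V k) _ _) (cong (distanceSum k +_) (*-distribˡ-∑ (V k) c _))))

module ClosedForms (c : ℕ) where
  open import Data.Integer using (ℤ; +_; _+_; _*_; _-_)
  open import Data.Integer.Properties using (pos-+; pos-*; *-zeroʳ)
  open import Data.Integer.Tactic.RingSolver using (solve-∀)
  import Data.Nat as ℕ
  open BetheTree using (module Recurrences; 2*wiener≡∑∑treeDist)
  open Recurrences c
  open ≡-Reasoning

  -- γ = d - 1 and δ = d.  The ring solver treats only bound variables as atoms, so each
  -- identity below is stated for an arbitrary g (with 1 + g for δ) and then applied to γ.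
  γ δ : ℤ
  γ = + c
  δ = + 1 + γ

  n s D χ : ℕ → ℤ
  n k = + order k
  s k = + depthSum k
  D k = + distanceSum k
  χ k = + (suc c ℕ.^ k)

  χ-suc : ∀ k → χ (suc k) ≡ δ * χ k
  χ-suc k = pos-* (suc c) _

  n-suc : ∀ k → n (suc k) ≡ + 1 + δ * n k
  n-suc k = trans (cong +_ (order-suc k)) (cong (λ t → + 1 + t) (pos-* (suc c) (order k)))

  cast-n+s : ∀ k → + (order k ℕ.+ depthSum k) ≡ n k + s k
  cast-n+s k = pos-+ (order k) (depthSum k)

  s-suc : ∀ k → s (suc k) ≡ δ * (n k + s k)
  s-suc k = trans (cong +_ (depthSum-suc k)) (trans (pos-* (suc c) _) (cong (δ *_) (cast-n+s k)))

  D-suc : ∀ k → D (suc k) ≡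
    δ * (n k + s k) + δ * ((n k + s k) + (D k + γ * (n k * (n k + s k) + n k * (n k + s k))))
  D-suc k = begin
    D (suc k)
      ≡⟨ cong +_ (distanceSum-suc k) ⟩
    + (suc c ℕ.* P ℕ.+ suc c ℕ.* (P ℕ.+ (distanceSum k ℕ.+ c ℕ.* crossSum k)))
      ≡⟨ pos-+ (suc c ℕ.* P) _ ⟩
    + (suc c ℕ.* P) + + (suc c ℕ.* (P ℕ.+ (distanceSum k ℕ.+ c ℕ.* crossSum k)))
      ≡⟨ cong₂ _+_ (pos-* (suc c) P) (pos-* (suc c) _) ⟩
    δ * + P + δ * + (P ℕ.+ (distanceSum k ℕ.+ c ℕ.* crossSum k))
      ≡⟨ cong₂ (λ a b → δ * a + δ * b) (cast-n+s k)
               (trans (pos-+ P _) (cong₂ _+_ (cast-n+s k)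
                 (trans (pos-+ (distanceSum k) _) (cong (λ t → D k + t) (pos-* c _))))) ⟩
    δ * (n k + s k) + δ * ((n k + s k) + (D k + γ * + crossSum k))
      ≡⟨ cong (λ b → δ * (n k + s k) + δ * ((n k + s k) + (D k + γ * b))) cross-cast ⟩
    δ * (n k + s k) + δ * ((n k + s k) + (D k + γ * (n k * (n k + s k) + n k * (n k + s k)))) ∎
    where
    P : ℕ
    P = order k ℕ.+ depthSum k
    cross-cast : + crossSum k ≡ n k * (n k + s k) + n k * (n k + s k)
    cross-cast = trans (cong +_ (crossSum-closed k))
      (trans (pos-+ (order k ℕ.* P) _) (cong₂ _+_ (trans (pos-* (order k) P) (cong (n k *_) (cast-n+s k)))
                                                    (trans (pos-* (order k) P) (cong (n k *_) (cast-n+s k)))))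

  scaled-n : ∀ k → γ * n (suc k) ≡ γ + δ * (γ * n k)
  scaled-n k = trans (cong (γ *_) (n-suc k)) (identity γ (n k))
    where
    identity : ∀ g x → g * (+ 1 + (+ 1 + g) * x) ≡ g + (+ 1 + g) * (g * x)
    identity = solve-∀

  scaled-s : ∀ k → γ * γ * s (suc k) ≡ δ * (γ * (γ * n k) + γ * γ * s k)
  scaled-s k = trans (cong (γ * γ *_) (s-suc k)) (identity γ (n k) (s k))
    where
    identity : ∀ g x y → g * g * ((+ 1 + g) * (x + y)) ≡ (+ 1 + g) * (g * (g * x) + g * g * y)
    identity = solve-∀

  scaled-D : ∀ k → γ * γ * γ * D (suc k) ≡
    + 2 * δ * (+ 1 + γ * n k) * (γ * γ * (γ * n k) + γ * (γ * γ * s k)) + δ * (γ * γ * γ * D k)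
  scaled-D k = trans (cong (γ * γ * γ *_) (D-suc k)) (identity γ (n k) (s k) (D k))
    where
    identity : ∀ g x y z →
      g * g * g * ((+ 1 + g) * (x + y) + (+ 1 + g) * ((x + y) + (z + g * (x * (x + y) + x * (x + y)))))
        ≡ + 2 * (+ 1 + g) * (+ 1 + g * x) * (g * g * (g * x) + g * (g * g * y)) + (+ 1 + g) * (g * g * g * z)
    identity = solve-∀

  countForm depthForm distanceForm : ℕ → ℤ
  countForm k = χ k - + 1
  depthForm k = + k * γ * χ k - δ * (χ k - + 1)
  distanceForm k = + 2 * χ k * ((+ k - + 1) * γ * (χ k + + 1) - + 2 * (χ k - δ))

  countForm-suc : ∀ k → countForm (suc k) ≡ γ + δ * countForm k
  countForm-suc k = trans (cong (λ x → x - + 1) (χ-suc k)) (identity γ (χ k))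
    where
    identity : ∀ g x → (+ 1 + g) * x - + 1 ≡ g + (+ 1 + g) * (x - + 1)
    identity = solve-∀

  depthForm-suc : ∀ k → depthForm (suc k) ≡ δ * (γ * countForm k + depthForm k)
  depthForm-suc k = trans (cong (λ x → + suc k * γ * x - δ * (x - + 1)) (χ-suc k)) (identity γ (+ k) (χ k))
    where
    identity : ∀ g κ x → (+ 1 + κ) * g * ((+ 1 + g) * x) - (+ 1 + g) * ((+ 1 + g) * x - + 1)
                         ≡ (+ 1 + g) * (g * (x - + 1) + (κ * g * x - (+ 1 + g) * (x - + 1)))
    identity = solve-∀

  distanceForm-suc : ∀ k → distanceForm (suc k) ≡
    + 2 * δ * (+ 1 + countForm k) * (γ * γ * countForm k + γ * depthForm k) + δ * distanceForm k
  distanceForm-suc k =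
    trans (cong (λ x → + 2 * x * ((+ suc k - + 1) * γ * (x + + 1) - + 2 * (x - δ))) (χ-suc k))
          (identity γ (+ k) (χ k))
    where
    identity : ∀ g κ x →
      + 2 * ((+ 1 + g) * x) * (((+ 1 + κ) - + 1) * g * ((+ 1 + g) * x + + 1) - + 2 * ((+ 1 + g) * x - (+ 1 + g)))
        ≡ + 2 * (+ 1 + g) * (+ 1 + (x - + 1)) * (g * g * (x - + 1) + g * (κ * g * x - (+ 1 + g) * (x - + 1)))
          + (+ 1 + g) * (+ 2 * x * ((κ - + 1) * g * (x + + 1) - + 2 * (x - (+ 1 + g))))
    identity = solve-∀

  count-closed : ∀ k → γ * n k ≡ countForm k
  count-closed zero = *-zeroʳ γ
  count-closed (suc k) = begin
    γ * n (suc k)        ≡⟨ scaled-n k ⟩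
    γ + δ * (γ * n k)    ≡⟨ cong (λ t → γ + δ * t) (count-closed k) ⟩
    γ + δ * countForm k  ≡⟨ countForm-suc k ⟨
    countForm (suc k)    ∎

  depth-closed : ∀ k → γ * γ * s k ≡ depthForm k
  depth-closed zero = identity γ
    where
    identity : ∀ g → g * g * + 0 ≡ + 0 * g * + 1 - (+ 1 + g) * (+ 1 - + 1)
    identity = solve-∀
  depth-closed (suc k) = begin
    γ * γ * s (suc k)
      ≡⟨ scaled-s k ⟩
    δ * (γ * (γ * n k) + γ * γ * s k)
      ≡⟨ cong₂ (λ a b → δ * (γ * a + b)) (count-closed k) (depth-closed k) ⟩
    δ * (γ * countForm k + depthForm k)
      ≡⟨ depthForm-suc k ⟨
    depthForm (suc k) ∎

  distance-closed : ∀ k → γ * γ * γ * D k ≡ distanceForm k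
  distance-closed zero = identity γ
    where
    identity : ∀ g → g * g * g * + 0 ≡ + 2 * + 1 * ((+ 0 - + 1) * g * (+ 1 + + 1) - + 2 * (+ 1 - (+ 1 + g)))
    identity = solve-∀
  distance-closed (suc k) = begin
    γ * γ * γ * D (suc k)
      ≡⟨ scaled-D k ⟩
    + 2 * δ * (+ 1 + γ * n k) * (γ * γ * (γ * n k) + γ * (γ * γ * s k)) + δ * (γ * γ * γ * D k)
      ≡⟨ cong₃ (λ a b e → + 2 * δ * (+ 1 + a) * (γ * γ * a + γ * b) + δ * e)
               (count-closed k) (depth-closed k) (distance-closed k) ⟩
    + 2 * δ * (+ 1 + countForm k) * (γ * γ * countForm k + γ * depthForm k) + δ * distanceForm k
      ≡⟨ distanceForm-suc k ⟨
    distanceForm (suc k) ∎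
    where
    cong₃ : ∀ {A B C R : Set} (f : A → B → C → R) {a a' b b' e e'} →
            a ≡ a' → b ≡ b' → e ≡ e' → f a b e ≡ f a' b' e'
    cong₃ f refl refl refl = refl

  cube-cast : + (c ℕ.^ 3) ≡ γ * γ * γ
  cube-cast = begin
    + (c ℕ.* (c ℕ.* (c ℕ.* 1)))
      ≡⟨ trans (pos-* c _) (cong (γ *_) (trans (pos-* c _) (cong (γ *_) (pos-* c 1)))) ⟩
    γ * (γ * (γ * + 1))
      ≡⟨ identity γ ⟩
    γ * γ * γ ∎
    where
    identity : ∀ g → g * (g * (g * + 1)) ≡ g * g * g
    identity = solve-∀

  wiener-closed : ∀ m {dist} → IsDistance (suc m) (suc c) dist →
    + 2 * (+ (c ℕ.^ 3) * + wiener (suc m) (suc c) dist)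
      ≡ + 2 * (χ (suc m) * (+ m * γ * (χ (suc m) + + 1) - + 2 * δ * (χ m - + 1)))
  wiener-closed m {dist} isDist = begin
    + 2 * (+ (c ℕ.^ 3) * W)
      ≡⟨ cong (λ t → + 2 * (t * W)) cube-cast ⟩
    + 2 * (γ * γ * γ * W)
      ≡⟨ regroup γ W ⟩
    γ * γ * γ * (+ 2 * W)
      ≡⟨ cong (γ * γ * γ *_) (trans (sym (pos-* 2 w)) (cong +_ (2*wiener≡∑∑treeDist _ _ isDist))) ⟩
    γ * γ * γ * D (suc m)
      ≡⟨ distance-closed (suc m) ⟩
    distanceForm (suc m)
      ≡⟨ cong (λ x → + 2 * x * (+ m * γ * (x + + 1) - + 2 * (x - δ))) (χ-suc m) ⟩
    + 2 * (δ * χ m) * (+ m * γ * (δ * χ m + + 1) - + 2 * (δ * χ m - δ))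
      ≡⟨ factor γ (+ m) (χ m) ⟩
    + 2 * (δ * χ m * (+ m * γ * (δ * χ m + + 1) - + 2 * δ * (χ m - + 1)))
      ≡⟨ cong (λ x → + 2 * (x * (+ m * γ * (x + + 1) - + 2 * δ * (χ m - + 1)))) (χ-suc m) ⟨
    + 2 * (χ (suc m) * (+ m * γ * (χ (suc m) + + 1) - + 2 * δ * (χ m - + 1))) ∎
    where
    w : ℕ
    w = wiener (suc m) (suc c) dist
    W : ℤ
    W = + w
    regroup : ∀ g w → + 2 * (g * g * g * w) ≡ g * g * g * (+ 2 * w)
    regroup = solve-∀
    factor : ∀ g μ x →
      + 2 * ((+ 1 + g) * x) * (μ * g * ((+ 1 + g) * x + + 1) - + 2 * ((+ 1 + g) * x - (+ 1 + g)))
        ≡ + 2 * ((+ 1 + g) * x * (μ * g * ((+ 1 + g) * x + + 1) - + 2 * (+ 1 + g) * (x - + 1)))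
    factor = solve-∀

open import Data.Integer using (ℤ; +_; _*_; _+_; _-_)
open import Data.Integer.Properties using (*-cancelˡ-≡)

corollary2p5 : (k d : ℕ) → 1 ≤ k → 2 ≤ d →
    (dist : Vtx d → Vtx d → ℕ) → IsDistance k d dist →
    (+ ((d ∸ 1) ^ 3)) * (+ wiener k d dist)
      ≡ (+ (d ^ k)) * ((+ (k ∸ 1)) * (+ (d ∸ 1)) * (+ (d ^ k) + + 1)
                        - (+ 2) * (+ d) * (+ (d ^ (k ∸ 1)) - + 1))
-- The hypotheses serve only to exclude k = 0 and d = 0; the case d = 1 is covered as well.
corollary2p5 (suc m) (suc c) _ _ dist isDist =
  *-cancelˡ-≡ (+ 2) _ _ (ClosedForms.wiener-closed c m isDist)
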